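{- No graph with tree-width \(2\) is the underlying graph of a complete-convex \(2\)-edge-coloured graph.
   Context: A \(2\)-edge-coloured graph is a pair \((G,c_G)\), \(G\) a graph without parallel edges and \(c_G:E_G\to\{R,B\}\); \(G\) is its underlying graph. A path \(u,v,w\) with \(uv,vw\in E_G\), \(u\ne v\ne w\), is an alternating \(2\)-path with centre \(v\) if \(c_G(uv)\ne c_G(vw)\). A vertex set \(S\) is convex if no vertex outside \(S\) is the centre of an alternating \(2\)-path with both ends in \(S\); \(conv(S)\) is the smallest convex set containing \(S\), \(conv(uv)=conv(\{u,v\})\). \((G,c_G)\) is complete convex if \(conv(uv)=V_G\) for every edge \(uv\). -}

module Defs where

open import Data.Nat using (ℕ; zero; suc; _≤_; _+_)
open import Data.Bool using (Bool; true; false)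
open import Data.Fin using (Fin; zero; suc; inject₁; fromℕ)
open import Data.Fin.Subset using (Subset; _∈_; _∉_; _⊆_; ∣_∣; ⁅_⁆; _∪_; ⊤)
open import Data.Product using (Σ; ∃; _×_; _,_)
open import Data.Empty using (⊥)
open import Relation.Nullary using (¬_)
open import Relation.Binary.PropositionalEquality using (_≡_; _≢_)
open import Function.Definitions using (Injective)

record Graph : Set where
  field
    n      : ℕ
    adj    : Fin n → Fin n → Bool
    sym    : ∀ u v → adj u v ≡ adj v u
    irrefl : ∀ u → adj u u ≡ false

  Edge : Fin n → Fin n → Set
  Edge u v = adj u v ≡ true

open Graph public

data Walk {m : ℕ} (E : Fin m → Fin m → Set) (P : Fin m → Set)
          : Fin m → Fin m → Set where
  here : ∀ {x} → Walk E P x x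
  step : ∀ {x y z} → E x y → P y → Walk E P y z → Walk E P x z

ConnectedOn : {m : ℕ} (E : Fin m → Fin m → Set) (P : Fin m → Set) → Set
ConnectedOn E P = ∀ s t → P s → P t → Walk E P s t

data Always {m : ℕ} (x : Fin m) : Set where
  tt : Always x

record Cycle (G : Graph) : Set where
  field
    k     : ℕ
    f     : Fin (suc (suc (suc k))) → Fin (n G)
    inj   : Injective _≡_ _≡_ f
    cons  : ∀ (i : Fin (suc (suc k))) → Edge G (f (inject₁ i)) (f (suc i))
    close : Edge G (f (fromℕ (suc (suc k)))) (f zero)

-- a tree: non-empty (guaranteed when used below), connected, acyclic
IsTree : Graph → Set
IsTree T = ConnectedOn (Edge T) Always × ¬ Cycle T

record TreeDecomposition (G : Graph) : Set where
  field
    T       : Graph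
    nonempty : Fin (n T)
    isTree  : IsTree T
    bag     : Fin (n T) → Subset (n G)
    cover   : ∀ v → ∃ λ t → v ∈ bag t
    edgeIn  : ∀ u v → Edge G u v → ∃ λ t → (u ∈ bag t × v ∈ bag t)
    subtree : ∀ v → ConnectedOn (Edge T) (λ t → v ∈ bag t)

HasWidth≤ : (G : Graph) → TreeDecomposition G → ℕ → Set
HasWidth≤ G D k = ∀ t → ∣ TreeDecomposition.bag D t ∣ ≤ suc k

TreeWidth : Graph → ℕ → Set
TreeWidth G k =
  (Σ (TreeDecomposition G) λ D → HasWidth≤ G D k) ×
  (∀ j → Σ (TreeDecomposition G) (λ D → HasWidth≤ G D j) → k ≤ j)

data Colour : Set where
  R B : Colour

-- an edge colouring is given as a symmetric function on vertex pairs;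
-- only its values on edges matter
record Colouring (G : Graph) : Set where
  field
    col : Fin (n G) → Fin (n G) → Colour
    col-sym : ∀ u v → col u v ≡ col v u

open Colouring public

AltCentre : (G : Graph) → Colouring G → Fin (n G) → Fin (n G) → Fin (n G) → Set
AltCentre G c u v w =
  Edge G u v × Edge G v w × u ≢ v × v ≢ w × u ≢ w × col c u v ≢ col c v w

Convex : (G : Graph) → Colouring G → Subset (n G) → Set
Convex G c S = ∀ u v w → v ∉ S → u ∈ S → w ∈ S → ¬ AltCentre G c u v w

-- conv(S): intersection of all convex sets containing S
-- (this intersection is itself convex, hence the smallest such set)
InConv : (G : Graph) → Colouring G → Subset (n G) → Fin (n G) → Set
InConv G c S x = ∀ (C : Subset (n G)) → Convex G c C → S ⊆ C → x ∈ C

CompleteConvex : (G : Graph) → Colouring G → Set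
CompleteConvex G c =
  ∀ u v → Edge G u v → ∀ x → InConv G c (⁅ u ⁆ ∪ ⁅ v ⁆) x

-- A decomposition of width 2 can be pruned leaf by leaf (dropping a leaf whose bag lies in its
-- neighbour's bag) until some bag, of size at most 3, contains a vertex x together with all its
-- neighbours.  In a complete-convex graph, for every edge x y and vertex z ∉ {x, y} the set
-- {x, y} is not convex, so some vertex outside it is the centre of an alternating path x v y.
-- If x itself were the centre of an alternating path y x z, this applied to the edges x y and
-- x z, where the centre can only be the remaining neighbour of x, would force the triangle
-- x y z to carry three distinct colours.  Hence x is no centre at
-- all, so V ∖ {x} is convex and every edge meets x; it follows that G is edgeless or has only
-- two vertices, and then a star gives a tree decomposition of width 1, contradicting width 2.
module Submission where

open import Defs hiding (sym)
open import Data.Bool using (Bool; true; false)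
open import Data.Bool.Properties using () renaming (_≟_ to _≟ᵇ_)
open import Data.Empty using (⊥; ⊥-elim)
open import Data.Fin as Fin using (Fin; zero; suc; toℕ)
open import Data.Fin.Properties
  using (any?; all?; pigeonhole; toℕ-inject₁; toℕ-fromℕ; toℕ≤pred[n]; toℕ-mono-<; <-cmp)
  renaming (_≟_ to _≟ᶠ_; _<?_ to _<ᶠ?_)
open import Data.Fin.Subset
  using (Subset; _∈_; _∉_; _⊆_; _⊂_; ∣_∣; ⁅_⁆; _∪_; ⊤; _-_; _─_; inside; outside)
  renaming (⊥ to ∅)
open import Data.Fin.Subset.Induction using (⊂-wellFounded)
open import Data.Fin.Subset.Properties
  using (_∈?_; ∈⊤; x∈⁅x⁆; x∈⁅y⁆⇒x≡y; x∈p∪q⁻; x∈p∪q⁺; p─q⊆p; x∈p∧x≢y⇒x∈p-y; x∈p⇒p-x⊂p;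
         x∈p⇒∣p-x∣<∣p∣; ∣⊤∣≡n; ∣⊥∣≡0; ∣⁅x⁆∣≡1)
open import Data.Nat using (ℕ; zero; suc; _+_; _≤_; _<_; z≤n; s≤s)
open import Data.Nat.GeneralisedArithmetic using (fold)
open import Data.Nat.Induction using (<-rec)
open import Data.Nat.Properties
  using (+-assoc; +-comm; m≤n⇒∃[o]m+o≡n; n<1+n; ≤-trans; m≤n+m; ≤-reflexive; 1+n≰n; <⇒≱;
         +-monoʳ-≤; module ≤-Reasoning)
open import Data.Product using (Σ; ∃; ∃₂; _×_; _,_; proj₁; proj₂)
open import Data.Sum using (_⊎_; inj₁; inj₂)
open import Data.Vec.Base using (_∷_; here; there)
open import Function.Definitions using (Injective)
open import Induction.WellFounded using (module All)
open import Relation.Binary using (tri<; tri≈; tri>)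
open import Relation.Binary.PropositionalEquality
  using (_≡_; _≢_; refl; sym; trans; cong; subst; subst₂)
open import Relation.Nullary using (¬_; Dec; yes; no; ¬?)
open import Relation.Nullary.Decidable using (_×-dec_; _→-dec_)

≢-sym : ∀ {A : Set} {a b : A} → a ≢ b → b ≢ a
≢-sym a≢b b≡a = a≢b (sym b≡a)

injective-or-collision : ∀ {k m} (f : Fin k → Fin m) →
                         Injective _≡_ _≡_ f ⊎ ∃₂ λ i j → i Fin.< j × f i ≡ f j
injective-or-collision f with any? (λ i → any? (λ j → (i <ᶠ? j) ×-dec (f i ≟ᶠ f j)))
... | yes collision = inj₂ collision
... | no noCollision = inj₁ injective
  where
  injective : Injective _≡_ _≡_ f
  injective {i} {j} fi≡fj with <-cmp i j
  ... | tri< i<j _ _ = ⊥-elim (noCollision (i , j , i<j , fi≡fj))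
  ... | tri≈ _ i≡j _ = i≡j
  ... | tri> _ _ j<i = ⊥-elim (noCollision (j , i , j<i , sym fi≡fj))

covered-by-two⇒≤2 : ∀ {m} (x y : Fin m) → (∀ v → v ≡ x ⊎ v ≡ y) → m ≤ 2
covered-by-two⇒≤2 {zero}             _ _ _ = z≤n
covered-by-two⇒≤2 {suc zero}         _ _ _ = s≤s z≤n
covered-by-two⇒≤2 {suc (suc zero)}   _ _ _ = s≤s (s≤s z≤n)
covered-by-two⇒≤2 {suc (suc (suc _))} x y cover
  with cover zero | cover (suc zero) | cover (suc (suc zero))
... | inj₁ refl | inj₁ ()   | _
... | inj₂ refl | inj₂ ()   | _
... | inj₁ refl | inj₂ refl | inj₁ ()
... | inj₁ refl | inj₂ refl | inj₂ ()
... | inj₂ refl | inj₁ refl | inj₁ ()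
... | inj₂ refl | inj₁ refl | inj₂ ()

x∈p─q⇒x∉q : ∀ {m} (p q : Subset m) {x} → x ∈ p ─ q → x ∉ q
x∈p─q⇒x∉q (_ ∷ p) (inside  ∷ q) ()             here
x∈p─q⇒x∉q (_ ∷ p) (outside ∷ q) here           ()
x∈p─q⇒x∉q (_ ∷ p) (_       ∷ q) (there x∈p─q) (there x∈q) = x∈p─q⇒x∉q p q x∈p─q x∈q

module _ {m : ℕ} where

  x∈p-y⇒x≢y : ∀ (p : Subset m) {x y} → x ∈ p - y → x ≢ y
  x∈p-y⇒x≢y p {y = y} x∈p-y refl = x∈p─q⇒x∉q p ⁅ y ⁆ x∈p-y (x∈⁅x⁆ y)

  x∈p-y⇒x∈p : ∀ (p : Subset m) {x y} → x ∈ p - y → x ∈ p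
  x∈p-y⇒x∈p p {y = y} = p─q⊆p p ⁅ y ⁆

  x∈⊤-y : ∀ {x y : Fin m} → x ≢ y → x ∈ ⊤ - y
  x∈⊤-y = x∈p∧x≢y⇒x∈p-y ∈⊤

  x∉⊤-y⇒x≡y : ∀ {x y : Fin m} → x ∉ ⊤ - y → x ≡ y
  x∉⊤-y⇒x≡y {x} {y} x∉ with x ≟ᶠ y
  ... | yes x≡y = x≡y
  ... | no x≢y = ⊥-elim (x∉ (x∈⊤-y x≢y))

  p⊆q⊎p⊈q : ∀ (p q : Subset m) → p ⊆ q ⊎ ∃ λ x → x ∈ p × x ∉ q
  p⊆q⊎p⊈q p q with any? (λ x → (x ∈? p) ×-dec ¬? (x ∈? q))
  ... | yes witness = inj₂ witness
  ... | no none = inj₁ p⊆q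
    where
    p⊆q : p ⊆ q
    p⊆q {x} x∈p with x ∈? q
    ... | yes x∈q = x∈q
    ... | no x∉q = ⊥-elim (none (x , x∈p , x∉q))

  ∣p∣≤3⇒fourth≡third : ∀ {K : Subset m} {x y z w} → ∣ K ∣ ≤ 3 →
                       x ∈ K → y ∈ K → z ∈ K → w ∈ K →
                       x ≢ y → x ≢ z → y ≢ z → w ≢ x → w ≢ y → w ≡ z
  ∣p∣≤3⇒fourth≡third {K} {x} {y} {z} {w} ∣K∣≤3 x∈ y∈ z∈ w∈ x≢y x≢z y≢z w≢x w≢y with w ≟ᶠ z
  ... | yes w≡z = w≡z
  ... | no w≢z = ⊥-elim (<⇒≱ 4≤∣K∣ ∣K∣≤3)
    where
    y∈K-x = x∈p∧x≢y⇒x∈p-y y∈ (≢-sym x≢y)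
    z∈K-x-y = x∈p∧x≢y⇒x∈p-y (x∈p∧x≢y⇒x∈p-y z∈ (≢-sym x≢z)) (≢-sym y≢z)
    w∈K-x-y-z = x∈p∧x≢y⇒x∈p-y (x∈p∧x≢y⇒x∈p-y (x∈p∧x≢y⇒x∈p-y w∈ w≢x) w≢y) w≢z
    open ≤-Reasoning
    4≤∣K∣ : 4 ≤ ∣ K ∣
    4≤∣K∣ = begin
      4                     ≤⟨ +-monoʳ-≤ 3 (≤-trans (s≤s z≤n) (x∈p⇒∣p-x∣<∣p∣ w∈K-x-y-z)) ⟩
      3 + ∣ K - x - y - z ∣ ≤⟨ +-monoʳ-≤ 2 (x∈p⇒∣p-x∣<∣p∣ z∈K-x-y) ⟩
      2 + ∣ K - x - y ∣     ≤⟨ +-monoʳ-≤ 1 (x∈p⇒∣p-x∣<∣p∣ y∈K-x) ⟩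
      1 + ∣ K - x ∣         ≤⟨ x∈p⇒∣p-x∣<∣p∣ x∈ ⟩
      ∣ K ∣                 ∎

  pair : Fin m → Fin m → Subset m
  pair x y = ⁅ x ⁆ ∪ ⁅ y ⁆

  x∈pair : ∀ {x y} → x ∈ pair x y
  x∈pair {x} = x∈p∪q⁺ (inj₁ (x∈⁅x⁆ x))

  y∈pair : ∀ {x y} → y ∈ pair x y
  y∈pair {y = y} = x∈p∪q⁺ (inj₂ (x∈⁅x⁆ y))

  ∈pair⁻ : ∀ {x y z} → z ∈ pair x y → z ≡ x ⊎ z ≡ y
  ∈pair⁻ {x} {y} z∈ with x∈p∪q⁻ ⁅ x ⁆ ⁅ y ⁆ z∈
  ... | inj₁ z∈⁅x⁆ = inj₁ (x∈⁅y⁆⇒x≡y x z∈⁅x⁆)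
  ... | inj₂ z∈⁅y⁆ = inj₂ (x∈⁅y⁆⇒x≡y y z∈⁅y⁆)

  ∉pair⁺ : ∀ {x y z} → z ≢ x → z ≢ y → z ∉ pair x y
  ∉pair⁺ z≢x z≢y z∈ with ∈pair⁻ z∈
  ... | inj₁ z≡x = z≢x z≡x
  ... | inj₂ z≡y = z≢y z≡y

  ∉pair⁻ : ∀ {x y z} → z ∉ pair x y → z ≢ x × z ≢ y
  ∉pair⁻ z∉ = (λ { refl → z∉ x∈pair }) , (λ { refl → z∉ y∈pair })

  pair⊆ : ∀ {x y S} → x ∈ S → y ∈ S → pair x y ⊆ S
  pair⊆ x∈ y∈ z∈ with ∈pair⁻ z∈
  ... | inj₁ refl = x∈
  ... | inj₂ refl = y∈

module _ (H : Graph) where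

  Edge-sym : ∀ {u v} → Edge H u v → Edge H v u
  Edge-sym {u} {v} uv = trans (Graph.sym H v u) uv

  Edge-irrefl : ∀ {u v} → Edge H u v → u ≢ v
  Edge-irrefl {u} uv refl with trans (sym uv) (irrefl H u)
  ... | ()

  Edge? : ∀ u v → Dec (Edge H u v)
  Edge? u v = adj H u v ≟ᵇ true

  Edgeless : Set
  Edgeless = ∀ u v → ¬ Edge H u v

  ClosedNeighbourhoodIn : Fin (n H) → Subset (n H) → Set
  ClosedNeighbourhoodIn x K = x ∈ K × (∀ w → Edge H x w → w ∈ K)

  EdgesWithin : Subset (n H) → Set
  EdgesWithin W = ∀ u v → Edge H u v → u ∈ W × v ∈ W

  EdgesWithinTwoVertices : Set
  EdgesWithinTwoVertices = ∃ λ W → ∣ W ∣ ≤ 2 × EdgesWithin W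

  edgeless⇒edges-within-two : Edgeless → EdgesWithinTwoVertices
  edgeless⇒edges-within-two edgeless =
    ∅ , subst (_≤ 2) (sym (∣⊥∣≡0 (n H))) z≤n , λ u v uv → ⊥-elim (edgeless u v uv)

Walk-weaken : ∀ {m} {E : Fin m → Fin m → Set} {P Q : Fin m → Set} →
              (∀ {u} → P u → Q u) → ∀ {a b} → Walk E P a b → Walk E Q a b
Walk-weaken P⇒Q here         = here
Walk-weaken P⇒Q (step e p w) = step e (P⇒Q p) (Walk-weaken P⇒Q w)

module NonBacktracking (H : Graph) (s : ℕ → Fin (n H))
  (edge : ∀ i → Edge H (s i) (s (suc i)))
  (nonbacktracking : ∀ i → s (suc (suc i)) ≢ s i) where

  -- Written toℕ x + a rather than a + toℕ x so that x = 0 and successor steps reduce definitionally.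
  window : ℕ → (d : ℕ) → Fin (suc d) → Fin (n H)
  window a d x = s (toℕ x + a)

  injective-window⇒cycle : ∀ a d → Injective _≡_ _≡_ (window a d) → s a ≡ s (suc d + a) → Cycle H
  injective-window⇒cycle a zero          _   closed = ⊥-elim (Edge-irrefl H (edge a) closed)
  injective-window⇒cycle a (suc zero)    _   closed = ⊥-elim (nonbacktracking a (sym closed))
  injective-window⇒cycle a (suc (suc k)) inj closed = record
    { k = k ; f = window a (suc (suc k)) ; inj = inj
    ; cons = λ i → subst (λ j → Edge H (s (j + a)) (s (suc (toℕ i + a))))
                         (sym (toℕ-inject₁ i)) (edge (toℕ i + a))
    ; close = subst₂ (Edge H) (cong (λ j → s (j + a)) (sym (toℕ-fromℕ (suc (suc k)))))
                              (sym closed) (edge (suc (suc k) + a)) }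

  repeat⇒cycle : ∀ d a → s a ≡ s (suc d + a) → Cycle H
  repeat⇒cycle = <-rec _ shorten
    where
    shorten : ∀ d → (∀ {d′} → d′ < d → ∀ a → s a ≡ s (suc d′ + a) → Cycle H) →
              ∀ a → s a ≡ s (suc d + a) → Cycle H
    shorten d rec a closed with injective-or-collision (window a d)
    ... | inj₁ inj = injective-window⇒cycle a d inj closed
    ... | inj₂ (i , j , i<j , repeat) with m≤n⇒∃[o]m+o≡n (toℕ-mono-< i<j)
    ... | d′ , i+d′≡j = rec d′<d (toℕ i + a) (trans repeat (cong s reindex))
      where
      d′<d : d′ < d
      d′<d = ≤-trans (s≤s (m≤n+m d′ (toℕ i))) (≤-trans (≤-reflexive i+d′≡j) (toℕ≤pred[n] j))
      reindex : toℕ j + a ≡ suc d′ + (toℕ i + a)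
      reindex = trans (cong (_+ a) (sym i+d′≡j))
                      (cong suc (trans (cong (_+ a) (+-comm (toℕ i) d′)) (+-assoc d′ (toℕ i) a)))

  cycle : Cycle H
  cycle with pigeonhole (n<1+n (n H)) (λ i → s (toℕ i))
  ... | i , j , i<j , repeat with m≤n⇒∃[o]m+o≡n (toℕ-mono-< i<j)
  ... | d , i+d≡j = repeat⇒cycle d (toℕ i) (trans repeat (cong s reindex))
    where
    reindex : toℕ j ≡ suc d + toℕ i
    reindex = trans (sym i+d≡j) (cong suc (+-comm (toℕ i) d))

module _ (H : Graph) where

  Pendant : Subset (n H) → Fin (n H) → Fin (n H) → Set
  Pendant A t s = t ∈ A × Edge H t s × s ∈ A × (∀ u → Edge H t u → u ∈ A → u ≡ s)

  Pendant? : ∀ A t s → Dec (Pendant A t s)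
  Pendant? A t s = (t ∈? A) ×-dec Edge? H t s ×-dec (s ∈? A)
                   ×-dec all? (λ u → Edge? H t u →-dec (u ∈? A) →-dec (u ≟ᶠ s))

  Walk-avoid : ∀ {P : Fin (n H) → Set} {t s} → (∀ u → Edge H t u → P u → u ≡ s) →
               ∀ {a b} → P a → b ≢ t → Walk (Edge H) P a b → Walk (Edge H) (λ u → P u × u ≢ t) a b
  Walk-avoid only-s pa b≢t here = here
  Walk-avoid {t = t} only-s pa b≢t (step {y = y} e py w) with y ≟ᶠ t
  ... | no y≢t = step e (py , y≢t) (Walk-avoid only-s py b≢t w)
  Walk-avoid only-s pa b≢t (step e py here) | yes refl = ⊥-elim (b≢t refl)
  Walk-avoid only-s {a} pa b≢t (step e py (step {y = z} e′ pz w)) | yes refl =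
    subst (λ x → Walk _ _ x _) (trans (only-s z e′ pz) (sym (only-s a (Edge-sym H e) pa)))
          (Walk-avoid only-s pz b≢t w)

  other-neighbour : ∀ {A t p} → ¬ Pendant A t p → t ∈ A → Edge H t p → p ∈ A →
                    ∃ λ q → Edge H t q × q ∈ A × q ≢ p
  other-neighbour {A} {t} {p} notPendant t∈A tp p∈A
    with any? (λ q → Edge? H t q ×-dec (q ∈? A) ×-dec ¬? (q ≟ᶠ p))
  ... | yes found = found
  ... | no none = ⊥-elim (notPendant (t∈A , tp , p∈A , only-p))
    where
    only-p : ∀ u → Edge H t u → u ∈ A → u ≡ p
    only-p u tu u∈A with u ≟ᶠ p
    ... | yes u≡p = u≡p
    ... | no u≢p = ⊥-elim (none (u , tu , u∈A , u≢p))

  module PendantFree (A : Subset (n H)) (pendant-free : ∀ t s → ¬ Pendant A t s) where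

    record Arc : Set where
      constructor arc
      field
        tail head : Fin (n H)
        edge : Edge H tail head
        tail∈ : tail ∈ A
        head∈ : head ∈ A

    turn : (a : Arc) → ∃ λ q → Edge H (Arc.head a) q × q ∈ A × q ≢ Arc.tail a
    turn (arc p t pt p∈A t∈A) = other-neighbour (pendant-free t p) t∈A (Edge-sym H pt) p∈A

    next : Arc → Arc
    next a = let (q , tq , q∈A , _) = turn a in arc (Arc.head a) q tq (Arc.head∈ a) q∈A

    cycle : ∀ {p t} → Edge H p t → p ∈ A → t ∈ A → Cycle H
    cycle pt p∈A t∈A =
      NonBacktracking.cycle H (λ i → Arc.tail (walk i)) (λ i → Arc.edge (walk i))
                              (λ i → proj₂ (proj₂ (proj₂ (turn (walk i)))))
      where
      walk : ℕ → Arc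
      walk = fold (arc _ _ pt p∈A t∈A) next

module Pruning {G : Graph} (D : TreeDecomposition G) where
  open TreeDecomposition D

  record Subdecomposition (A : Subset (n T)) : Set where
    field
      root      : Fin (n T)
      root∈     : root ∈ A
      connected : ConnectedOn (Edge T) (_∈ A)
      covers    : ∀ u v → Edge G u v → ∃ λ t → t ∈ A × u ∈ bag t × v ∈ bag t
      occurrences-connected : ∀ v → ConnectedOn (Edge T) (λ t → t ∈ A × v ∈ bag t)

  Outcome : Set
  Outcome = (∃₂ λ t x → ClosedNeighbourhoodIn G x (bag t)) ⊎ Edgeless G

  whole : Subdecomposition ⊤
  whole = record
    { root = nonempty ; root∈ = ∈⊤
    ; connected = λ a b _ _ → Walk-weaken (λ _ → ∈⊤) (proj₁ isTree a b tt tt)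
    ; covers = λ u v uv → let (t , u∈ , v∈) = edgeIn u v uv in t , ∈⊤ , u∈ , v∈
    ; occurrences-connected = λ v a b (_ , v∈a) (_ , v∈b) →
        Walk-weaken (∈⊤ ,_) (subtree v a b v∈a v∈b) }

  module _ {A : Subset (n T)} (S : Subdecomposition A) where
    open Subdecomposition S

    -- x occurs in no other bag: its occurrences are connected and t's only neighbour s misses x.
    private-vertex : ∀ {t s x} → Pendant T A t s → x ∈ bag t → x ∉ bag s →
                     ClosedNeighbourhoodIn G x (bag t)
    private-vertex {t} {s} {x} (t∈A , _ , _ , only-s) x∈t x∉s = x∈t , neighbour∈t
      where
      neighbour∈t : ∀ w → Edge G x w → w ∈ bag t
      neighbour∈t w xw with covers x w xw
      ... | t′ , t′∈A , x∈t′ , w∈t′ with t′ ≟ᶠ t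
      ... | yes refl = w∈t′
      ... | no t′≢t with occurrences-connected x t t′ (t∈A , x∈t) (t′∈A , x∈t′)
      ...   | here = ⊥-elim (t′≢t refl)
      ...   | step ty (y∈A , x∈y) _ = ⊥-elim (x∉s (subst (λ y → x ∈ bag y) (only-s _ ty y∈A) x∈y))

    prune : ∀ {t s} → Pendant T A t s → bag t ⊆ bag s → Subdecomposition (A - t)
    prune {t} {s} (t∈A , ts , s∈A , only-s) t⊆s = record
      { root = s ; root∈ = s∈A-t
      ; connected = λ a b a∈ b∈ → Walk-weaken (λ (u∈A , u≢t) → x∈p∧x≢y⇒x∈p-y u∈A u≢t)
          (avoid-t (λ u∈A → u∈A) (x∈p-y⇒x∈p A a∈) (x∈p-y⇒x≢y A b∈)
            (connected a b (x∈p-y⇒x∈p A a∈) (x∈p-y⇒x∈p A b∈)))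
      ; covers = covers′
      ; occurrences-connected = λ v a b (a∈ , v∈a) (b∈ , v∈b) →
          Walk-weaken (λ ((u∈A , v∈u) , u≢t) → x∈p∧x≢y⇒x∈p-y u∈A u≢t , v∈u)
            (avoid-t proj₁ (x∈p-y⇒x∈p A a∈ , v∈a) (x∈p-y⇒x≢y A b∈)
              (occurrences-connected v a b (x∈p-y⇒x∈p A a∈ , v∈a) (x∈p-y⇒x∈p A b∈ , v∈b))) }
      where
      avoid-t : ∀ {P} → (∀ {u} → P u → u ∈ A) → ∀ {a b} → P a → b ≢ t →
                Walk (Edge T) P a b → Walk (Edge T) (λ u → P u × u ≢ t) a b
      avoid-t P⇒A = Walk-avoid T (λ u tu pu → only-s u tu (P⇒A pu))
      s∈A-t : s ∈ A - t
      s∈A-t = x∈p∧x≢y⇒x∈p-y s∈A (λ s≡t → Edge-irrefl T ts (sym s≡t))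
      covers′ : ∀ u v → Edge G u v → ∃ λ t′ → t′ ∈ A - t × u ∈ bag t′ × v ∈ bag t′
      covers′ u v uv with covers u v uv
      ... | t′ , t′∈A , u∈ , v∈ with t′ ≟ᶠ t
      ... | yes refl = s , s∈A-t , t⊆s u∈ , t⊆s v∈
      ... | no t′≢t = t′ , x∈p∧x≢y⇒x∈p-y t′∈A t′≢t , u∈ , v∈

    pendant-free⇒singleton : (∀ t s → ¬ Pendant T A t s) → ∀ {t} → t ∈ A → t ≡ root
    pendant-free⇒singleton pendant-free {t} t∈A with t ≟ᶠ root
    ... | yes t≡root = t≡root
    ... | no t≢root with connected root t root∈ t∈A
    ...   | here = ⊥-elim (t≢root refl)
    ...   | step {y = y} root-y y∈A _ =
            ⊥-elim (proj₂ isTree (PendantFree.cycle T A pendant-free root-y root∈ y∈A))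

    singleton-outcome : (∀ {t} → t ∈ A → t ≡ root) → Outcome
    singleton-outcome only-root with any? (_∈? bag root)
    ... | yes (x , x∈root) = inj₁ (root , x , x∈root , neighbour∈root)
      where
      neighbour∈root : ∀ w → Edge G x w → w ∈ bag root
      neighbour∈root w xw with covers x w xw
      ... | t , t∈A , _ , w∈t = subst (λ t → w ∈ bag t) (only-root t∈A) w∈t
    ... | no empty = inj₂ λ u v uv → let (t , t∈A , u∈t , _) = covers u v uv in
                                     empty (u , subst (λ t → u ∈ bag t) (only-root t∈A) u∈t)

  outcome : ∀ A → Subdecomposition A → Outcome
  outcome = All.wfRec ⊂-wellFounded _ (λ A → Subdecomposition A → Outcome) prune-or-stop
    where
    prune-or-stop : ∀ A → (∀ {B} → B ⊂ A → Subdecomposition B → Outcome) →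
                    Subdecomposition A → Outcome
    prune-or-stop A rec S with any? (λ t → any? (λ s → Pendant? T A t s))
    ... | no none =
          singleton-outcome S (pendant-free⇒singleton S λ t s pendant → none (t , s , pendant))
    ... | yes (t , s , pendant) with p⊆q⊎p⊈q (bag t) (bag s)
    ...   | inj₁ t⊆s = rec (x∈p⇒p-x⊂p (proj₁ pendant)) (prune S pendant t⊆s)
    ...   | inj₂ (x , x∈t , x∉s) = inj₁ (t , x , private-vertex S pendant x∈t x∉s)

  closed-neighbourhood-in-bag-or-edgeless : Outcome
  closed-neighbourhood-in-bag-or-edgeless = outcome ⊤ whole

no-three-distinct-colours : ∀ (a b d : Colour) → a ≢ b → b ≢ d → a ≢ d → ⊥
no-three-distinct-colours R R _ a≢b _   _   = a≢b refl
no-three-distinct-colours B B _ a≢b _   _   = a≢b refl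
no-three-distinct-colours R B R _   _   a≢d = a≢d refl
no-three-distinct-colours R B B _   b≢d _   = b≢d refl
no-three-distinct-colours B R R _   b≢d _   = b≢d refl
no-three-distinct-colours B R B _   _   a≢d = a≢d refl

_≟ᶜ_ : (a b : Colour) → Dec (a ≡ b)
R ≟ᶜ R = yes refl
R ≟ᶜ B = no λ ()
B ≟ᶜ R = no λ ()
B ≟ᶜ B = yes refl

module _ {G : Graph} (c : Colouring G) where

  AltCentre? : ∀ u v w → Dec (AltCentre G c u v w)
  AltCentre? u v w = Edge? G u v ×-dec Edge? G v w ×-dec ¬? (u ≟ᶠ v) ×-dec ¬? (v ≟ᶠ w)
                     ×-dec ¬? (u ≟ᶠ w) ×-dec ¬? (col c u v ≟ᶜ col c v w)

  AltCentre-reverse : ∀ {u v w} → AltCentre G c u v w → AltCentre G c w v u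
  AltCentre-reverse {u} {v} {w} (uv , vw , u≢v , v≢w , u≢w , uv≢vw) =
    Edge-sym G vw , Edge-sym G uv , ≢-sym v≢w , ≢-sym u≢v , ≢-sym u≢w ,
    λ wv≡vu → uv≢vw (trans (col-sym c u v) (trans (sym wv≡vu) (col-sym c w v)))

  AltCentre-ends-distinct : ∀ {u v w} → AltCentre G c u v w → u ≢ w
  AltCentre-ends-distinct (_ , _ , _ , _ , u≢w , _) = u≢w

module CompleteConvexGraph {G : Graph} (c : Colouring G) (cc : CompleteConvex G c) where

  nonconvex-witness : ∀ {u v z S} → Edge G u v → u ∈ S → v ∈ S → z ∉ S →
                      ∃₂ λ a b → ∃ λ d → b ∉ S × a ∈ S × d ∈ S × AltCentre G c a b d
  nonconvex-witness {u} {v} {z} {S} uv u∈ v∈ z∉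
    with any? (λ a → any? (λ b → any? (λ d →
           ¬? (b ∈? S) ×-dec (a ∈? S) ×-dec (d ∈? S) ×-dec AltCentre? c a b d)))
  ... | yes witness = witness
  ... | no none = ⊥-elim (z∉ (cc u v uv z S convex (pair⊆ u∈ v∈)))
    where
    convex : Convex G c S
    convex a b d b∉ a∈ d∈ alt = none (a , b , d , b∉ , a∈ , d∈ , alt)

  pair-witness : ∀ {x y z} → Edge G x y → z ∉ pair x y →
                 ∃ λ v → v ∉ pair x y × AltCentre G c x v y
  pair-witness xy z∉ with nonconvex-witness xy x∈pair y∈pair z∉
  ... | a , v , d , v∉ , a∈ , d∈ , alt with ∈pair⁻ a∈ | ∈pair⁻ d∈
  ... | inj₁ refl | inj₂ refl = v , v∉ , alt
  ... | inj₂ refl | inj₁ refl = v , v∉ , AltCentre-reverse c alt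
  ... | inj₁ refl | inj₁ refl = ⊥-elim (AltCentre-ends-distinct c alt refl)
  ... | inj₂ refl | inj₂ refl = ⊥-elim (AltCentre-ends-distinct c alt refl)

  non-centre-meets-every-edge : ∀ {x} → (∀ y z → ¬ AltCentre G c y x z) →
                                ∀ u v → Edge G u v → u ≡ x ⊎ v ≡ x
  non-centre-meets-every-edge {x} notCentre u v uv with u ≟ᶠ x | v ≟ᶠ x
  ... | yes u≡x | _       = inj₁ u≡x
  ... | no _    | yes v≡x = inj₂ v≡x
  ... | no u≢x  | no v≢x
    with nonconvex-witness uv (x∈⊤-y u≢x) (x∈⊤-y v≢x) (λ x∈ → x∈p-y⇒x≢y ⊤ x∈ refl)
  ... | a , b , d , b∉ , _ , _ , alt =
        ⊥-elim (notCentre a d (subst (λ b → AltCentre G c a b d) (x∉⊤-y⇒x≡y b∉) alt))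

  meets-every-edge⇒edgeless-or-two-vertices : ∀ {x} → (∀ u v → Edge G u v → u ≡ x ⊎ v ≡ x) →
                                              Edgeless G ⊎ ∃ λ y → ∀ v → v ≡ x ⊎ v ≡ y
  meets-every-edge⇒edgeless-or-two-vertices {x} meets with any? (Edge? G x)
  ... | no isolated = inj₁ edgeless
    where
    edgeless : Edgeless G
    edgeless u v uv with meets u v uv
    ... | inj₁ refl = isolated (v , uv)
    ... | inj₂ refl = isolated (u , Edge-sym G uv)
  ... | yes (y , xy) = inj₂ (y , x-or-y)
    where
    x-or-y : ∀ v → v ≡ x ⊎ v ≡ y
    x-or-y v with v ≟ᶠ x | v ≟ᶠ y
    ... | yes v≡x | _       = inj₁ v≡x
    ... | no _    | yes v≡y = inj₂ v≡y
    ... | no v≢x  | no v≢y with pair-witness xy (∉pair⁺ v≢x v≢y)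
    ...   | w , w∉ , (_ , wy , _) with meets w y wy
    ...     | inj₁ w≡x = ⊥-elim (proj₁ (∉pair⁻ w∉) w≡x)
    ...     | inj₂ y≡x = ⊥-elim (Edge-irrefl G xy (sym y≡x))

  small-closed-neighbourhood⇒not-centre : ∀ {x K} → ∣ K ∣ ≤ 3 → ClosedNeighbourhoodIn G x K →
                                          ∀ y z → ¬ AltCentre G c y x z
  small-closed-neighbourhood⇒not-centre {x} ∣K∣≤3 (x∈K , N[x]⊆K) y z
                                        (yx , xz , y≢x , x≢z , y≢z , yx≢xz) =
    no-three-distinct-colours (col c x y) (col c x z) (col c y z)
      (λ xy≡xz → yx≢xz (trans (col-sym c y x) xy≡xz))
      (λ xz≡yz → opposite-side (Edge-sym G yx) xz (≢-sym y≢x) x≢z y≢z (trans xz≡yz (col-sym c y z)))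
      (opposite-side xz (Edge-sym G yx) x≢z (≢-sym y≢x) (≢-sym y≢z))
    where
    opposite-side : ∀ {y z} → Edge G x y → Edge G x z → x ≢ y → x ≢ z → y ≢ z →
                    col c x z ≢ col c z y
    opposite-side {y} {z} xy xz x≢y x≢z y≢z with pair-witness xy (∉pair⁺ (≢-sym x≢z) (≢-sym y≢z))
    ... | v , v∉ , (xv , _ , _ , _ , _ , xv≢vy) = subst (λ v → col c x v ≢ col c v y) v≡z xv≢vy
      where
      v≡z : v ≡ z
      v≡z = ∣p∣≤3⇒fourth≡third ∣K∣≤3 x∈K (N[x]⊆K y xy) (N[x]⊆K z xz) (N[x]⊆K v xv)
                               x≢y x≢z y≢z (proj₁ (∉pair⁻ v∉)) (proj₂ (∉pair⁻ v∉))

  small-closed-neighbourhood⇒edges-within-two : ∀ {x K} → ∣ K ∣ ≤ 3 → ClosedNeighbourhoodIn G x K →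
                                                EdgesWithinTwoVertices G
  small-closed-neighbourhood⇒edges-within-two {x} ∣K∣≤3 closed
    with meets-every-edge⇒edgeless-or-two-vertices
           (non-centre-meets-every-edge (small-closed-neighbourhood⇒not-centre ∣K∣≤3 closed))
  ... | inj₁ edgeless = edgeless⇒edges-within-two G edgeless
  ... | inj₂ (y , x-or-y) =
        ⊤ , subst (_≤ 2) (sym (∣⊤∣≡n (n G))) (covered-by-two⇒≤2 x y x-or-y) , λ _ _ _ → ∈⊤ , ∈⊤

star-adj : ∀ {m} → Fin (suc m) → Fin (suc m) → Bool
star-adj zero    zero    = false
star-adj zero    (suc _) = true
star-adj (suc _) zero    = true
star-adj (suc _) (suc _) = false

Star : ℕ → Graph
Star m = record { n = suc m ; adj = star-adj ; sym = star-adj-sym ; irrefl = star-adj-irrefl }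
  where
  star-adj-sym : ∀ u v → star-adj u v ≡ star-adj v u
  star-adj-sym zero    zero    = refl
  star-adj-sym zero    (suc _) = refl
  star-adj-sym (suc _) zero    = refl
  star-adj-sym (suc _) (suc _) = refl
  star-adj-irrefl : ∀ u → star-adj u u ≡ false
  star-adj-irrefl zero    = refl
  star-adj-irrefl (suc _) = refl

module _ {m : ℕ} where

  star-2-path : ∀ {a b d} → Edge (Star m) a b → Edge (Star m) b d → b ≡ zero ⊎ (a ≡ zero × d ≡ zero)
  star-2-path {b = zero}            _ _ = inj₁ refl
  star-2-path {zero} {suc _} {zero} _ _ = inj₂ (refl , refl)

  star-connected : ConnectedOn (Edge (Star m)) Always
  star-connected zero    zero    _ _ = here
  star-connected zero    (suc _) _ _ = step refl tt here
  star-connected (suc _) zero    _ _ = step refl tt here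
  star-connected (suc _) (suc _) _ _ = step {y = zero} refl tt (step refl tt here)

  star-acyclic : ¬ Cycle (Star m)
  star-acyclic cycle with star-2-path (cons zero) (cons (suc zero))
    where open Cycle cycle
  ... | inj₂ (f0≡0 , f2≡0) with Cycle.inj cycle (trans f0≡0 (sym f2≡0))
  ...   | ()
  star-acyclic cycle | inj₁ f1≡0 = third-edge k refl
    where
    open Cycle cycle
    back-to-f1 : ∀ {i} → Edge (Star m) (f (suc (suc zero))) (f i) → i ≡ suc zero
    back-to-f1 e with star-2-path (cons (suc zero)) e
    ... | inj₁ f2≡0 with inj (trans f2≡0 (sym f1≡0))
    ...   | ()
    back-to-f1 e | inj₂ (_ , fi≡0) = inj (trans fi≡0 (sym f1≡0))
    third-edge : ∀ k′ → k ≡ k′ → ⊥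
    third-edge zero    refl with back-to-f1 close
    ... | ()
    third-edge (suc _) refl with back-to-f1 (cons (suc (suc zero)))
    ... | ()

star-decomposition : ∀ {G} → EdgesWithinTwoVertices G →
                     Σ (TreeDecomposition G) λ D → HasWidth≤ G D 1
star-decomposition {G} (W , ∣W∣≤2 , edgesWithin) = decomposition , width
  where
  bag : Fin (suc (n G)) → Subset (n G)
  bag zero    = W
  bag (suc v) = ⁅ v ⁆
  occurrences-connected : ∀ v → ConnectedOn (Edge (Star (n G))) (λ t → v ∈ bag t)
  occurrences-connected v zero    zero    _   _   = here
  occurrences-connected v zero    (suc _) _   v∈  = step refl v∈ here
  occurrences-connected v (suc _) zero    _   v∈  = step refl v∈ here
  occurrences-connected v (suc i) (suc j) v∈i v∈j with x∈⁅y⁆⇒x≡y i v∈i | x∈⁅y⁆⇒x≡y j v∈j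
  ... | refl | refl = here
  decomposition : TreeDecomposition G
  decomposition = record
    { T = Star (n G) ; nonempty = zero ; isTree = star-connected , star-acyclic ; bag = bag
    ; cover = λ v → suc v , x∈⁅x⁆ v ; edgeIn = λ u v uv → zero , edgesWithin u v uv
    ; subtree = occurrences-connected }
  width : HasWidth≤ G decomposition 1
  width zero    = ∣W∣≤2
  width (suc v) = subst (_≤ 2) (sym (∣⁅x⁆∣≡1 v)) (s≤s z≤n)

theorem17 : ∀ (G : Graph) → TreeWidth G 2 → (c : Colouring G) → ¬ CompleteConvex G c
theorem17 G ((D , width≤2) , minimal) c cc = 1+n≰n (minimal 1 (star-decomposition edgesWithinTwo))
  where
  edgesWithinTwo : EdgesWithinTwoVertices G
  edgesWithinTwo with Pruning.closed-neighbourhood-in-bag-or-edgeless D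
  ... | inj₁ (t , x , closed) =
        CompleteConvexGraph.small-closed-neighbourhood⇒edges-within-two c cc (width≤2 t) closed
  ... | inj₂ edgeless = edgeless⇒edges-within-two G edgeless
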